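{- Let $G_1$ and $G_2$ be graphs and let $H = G_1 \circ G_2$ be their lexicographic product. Then for every word-representable subgraph $G_1'$ of $G_1$, the lexicographic map $\mathcal{L}_H(G_1')$ is word-representable.
   Context: All graphs are simple, undirected and finite. A graph $G$ is word-representable if there is a word $w$ over the alphabet $V(G)$ such that for all distinct $x,y \in V(G)$, $xy \in E(G)$ iff the occurrences of $x$ and $y$ alternate in $w$. The lexicographic product $H = G_1 \circ G_2$ has vertex set $V(G_1)\times V(G_2)$, with $(u,v)$ and $(x,y)$ adjacent iff $\{u,x\}\in E(G_1)$, or $u=x$ and $\{v,y\}\in E(G_2)$. For $v_i \in V(G_1)$ the supervertex $V_i = \{(v_i,u) : u \in V(G_2)\}$. For a subgraph $G_1'$ of $G_1$, the lexicographic map $\mathcal{L}_H(G_1')$ is the subgraph of $H$ on vertex set $V(H)$ containing no edges inside any supervertex and, for each edge $v_iv_j \in E(G_1')$, all edges between $V_i$ and $V_j$ (and no other edges). -}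

module Defs where

open import Data.Nat using (ℕ)
open import Data.Fin using (Fin)
open import Data.Bool using (Bool; true; false)
open import Data.List using (List; []; _∷_; filter)
open import Data.List.Membership.Propositional using (_∈_)
open import Data.Product using (Σ; _×_; _,_; ∃-syntax)
open import Data.Sum using (_⊎_)
open import Data.Unit using (⊤)
open import Relation.Nullary using (¬_)
open import Relation.Nullary.Decidable using (_⊎-dec_)
open import Relation.Binary.Definitions using (DecidableEquality)
open import Relation.Binary.PropositionalEquality using (_≡_; _≢_)
open import Function.Bundles using (_⇔_)
open import Function.Definitions using (Injective)

record Graph (n : ℕ) : Set where
  field
    adj    : Fin n → Fin n → Bool
    sym    : ∀ u v → adj u v ≡ adj v u
    irrefl : ∀ u → adj u u ≡ false

open Graph public

NoConsecutiveRepeat : {V : Set} → List V → Set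
NoConsecutiveRepeat []            = ⊤
NoConsecutiveRepeat (a ∷ [])      = ⊤
NoConsecutiveRepeat (a ∷ b ∷ rest) = a ≢ b × NoConsecutiveRepeat (b ∷ rest)

Alternate : {V : Set} → DecidableEquality V → V → V → List V → Set
Alternate _≟_ x y w =
  NoConsecutiveRepeat (filter (λ z → (z ≟ x) ⊎-dec (z ≟ y)) w)

WordRepresentable : (V : Set) → DecidableEquality V → (V → V → Set) → Set
WordRepresentable V _≟_ E =
  Σ (List V) λ w →
    (∀ x → x ∈ w) ×
    (∀ x y → x ≢ y → (E x y ⇔ Alternate _≟_ x y w))

WordRepGraph : {n : ℕ} → Graph n → Set
WordRepGraph {n} G =
  WordRepresentable (Fin n) Data.Fin._≟_ (λ u v → adj G u v ≡ true)

IsSubgraphVia : {m n : ℕ} → Graph m → Graph n → (Fin m → Fin n) → Set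
IsSubgraphVia G' G f =
  Injective _≡_ _≡_ f ×
  (∀ p q → adj G' p q ≡ true → adj G (f p) (f q) ≡ true)

_≟ₚ_ : {n₁ n₂ : ℕ} → DecidableEquality (Fin n₁ × Fin n₂)
_≟ₚ_ = Data.Product.Properties.≡-dec Data.Fin._≟_ Data.Fin._≟_
  where import Data.Product.Properties

LexProductAdj : {n₁ n₂ : ℕ} → Graph n₁ → Graph n₂ →
                Fin n₁ × Fin n₂ → Fin n₁ × Fin n₂ → Set
LexProductAdj G₁ G₂ (u , v) (x , y) =
  adj G₁ u x ≡ true ⊎ (u ≡ x × adj G₂ v y ≡ true)

-- Edge relation of the lexicographic map L_H(G1') for H = G1 ∘ G2, where G1'
-- is embedded in G1 via f: (u,a) ~ (x,b) iff u x is the image of an edge of G1'.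
-- (Vertex set is all of V(H) = Fin n1 × Fin n2; no edges inside supervertices.)
LexMapAdj : {m n₁ n₂ : ℕ} → Graph m → (Fin m → Fin n₁) →
            Fin n₁ × Fin n₂ → Fin n₁ × Fin n₂ → Set
LexMapAdj G₁' f (u , a) (x , b) =
  ∃[ p ] ∃[ q ] (adj G₁' p q ≡ true × f p ≡ u × f q ≡ x)

module Submission where

-- Write E for the relation on V(G₁) given by the edges of G₁' carried along f.
-- First, E is word-representable: rename a word for G₁' along f and prefix each vertex
-- outside the image of f as a square uu, which alternates with nothing.  Second, if v
-- represents E then so does π(v) v, where π(v) lists the vertices in order of first
-- occurrence.  Replacing each letter u of π(v) by the supervertex V_u listed backwards and
-- each letter u of v by V_u listed forwards gives a word for L_H(G₁'): two vertices from
-- different supervertices V_u, V_u′ see a copy of π(v) v restricted to u, u′, which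
-- alternates iff v does, while two vertices of one supervertex V_u see the reversed
-- first block of V_u run into the block itself, hence a repeated letter.

open import Defs hiding (sym)
open import Data.Nat using (ℕ)
open import Data.Fin as Fin using (Fin)
open import Data.Product using (_×_; _,_; proj₁; proj₂; ∃-syntax; swap)

open import Level using (0ℓ)
import Data.Fin.Properties as Finₚ
open import Data.List using (List; []; _∷_; _++_; [_]; map; filter; reverse; concatMap; deduplicate; allFin)
open import Data.List.Properties
  using ( filter-++; filter-accept; filter-reject; filter-none; filter-≐; map-++; unfold-reverse; ++-assoc
        ; ++-identityʳ; concatMap-cong; concatMap-pure; map-concatMap; reverse-map; reverse-involutive )
open import Data.List.Membership.Propositional using (_∈_)
open import Data.List.Membership.Propositional.Properties
  using (∈-filter⁺; ∈-map⁺; ∈-deduplicate⁺; ∈-++⁺ˡ; ∈-++⁺ʳ; ∈-concatMap⁺; ∈-allFin)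
open import Data.List.Relation.Unary.All as All using (All; []; _∷_)
import Data.List.Relation.Unary.All.Properties as All
open import Data.List.Relation.Unary.Any as Any using (here; there)
import Data.List.Relation.Unary.Any.Properties as Anyₚ
open import Data.List.Relation.Unary.Unique.Propositional using (Unique; _∷_)
open import Data.List.Relation.Unary.Unique.Propositional.Properties using (allFin⁺)
open import Data.Product.Properties using (≡-dec)
open import Data.Sum as Sum using (_⊎_; inj₁; inj₂; [_,_]′)
open import Data.Empty using (⊥-elim)
open import Data.Unit using (tt)
open import Data.Bool using (true)
open import Function using (_∘_; id; _⇔_; mk⇔)
import Function.Properties.Equivalence as ⇔
open import Function.Definitions using (Injective)
open import Relation.Nullary using (¬_; Dec; yes; no; ¬?)
open import Relation.Nullary.Decidable using (_⊎-dec_)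
open import Relation.Unary using (Pred; Decidable)
open import Relation.Unary.Properties using (_∩?_)
open import Relation.Binary.Definitions using (DecidableEquality)
open import Relation.Binary.PropositionalEquality
  using (_≡_; _≢_; refl; sym; trans; cong; cong₂; subst; subst₂; module ≡-Reasoning)

module _ {A : Set} where

  NoConsecutiveRepeat-++⁻ʳ : ∀ xs {ys : List A} →
    NoConsecutiveRepeat (xs ++ ys) → NoConsecutiveRepeat ys
  NoConsecutiveRepeat-++⁻ʳ []                     h = h
  NoConsecutiveRepeat-++⁻ʳ (x ∷ [])      {[]}     _ = tt
  NoConsecutiveRepeat-++⁻ʳ (x ∷ [])      {y ∷ ys} h = proj₂ h
  NoConsecutiveRepeat-++⁻ʳ (x ∷ x′ ∷ xs)          h = NoConsecutiveRepeat-++⁻ʳ (x′ ∷ xs) (proj₂ h)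

  ¬NoConsecutiveRepeat-square : ∀ xs (c : A) ys → ¬ NoConsecutiveRepeat (xs ++ c ∷ c ∷ ys)
  ¬NoConsecutiveRepeat-square []       c ys (c≢c , _) = c≢c refl
  ¬NoConsecutiveRepeat-square (x ∷ xs) c ys h =
    ¬NoConsecutiveRepeat-square xs c ys (NoConsecutiveRepeat-++⁻ʳ [ x ] h)

  ¬NoConsecutiveRepeat-mirror : ∀ {x : A} s → x ∈ s → ∀ r₁ r₂ →
    ¬ NoConsecutiveRepeat (reverse (s ++ r₁) ++ s ++ r₂)
  ¬NoConsecutiveRepeat-mirror (c ∷ t) _ r₁ r₂ h =
    ¬NoConsecutiveRepeat-square (reverse (t ++ r₁)) c (t ++ r₂) (subst NoConsecutiveRepeat mirror h)
    where
    mirror : reverse (c ∷ t ++ r₁) ++ c ∷ t ++ r₂ ≡ reverse (t ++ r₁) ++ c ∷ c ∷ t ++ r₂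
    mirror = trans (cong (_++ c ∷ t ++ r₂) (unfold-reverse c (t ++ r₁)))
                   (++-assoc (reverse (t ++ r₁)) [ c ] (c ∷ t ++ r₂))

  NoConsecutiveRepeat-map : ∀ {B : Set} {f : A → B} → Injective _≡_ _≡_ f → ∀ s →
    NoConsecutiveRepeat (map f s) ⇔ NoConsecutiveRepeat s
  NoConsecutiveRepeat-map {f = f} f-inj s = mk⇔ (to s) (from s)
    where
    to : ∀ s → NoConsecutiveRepeat (map f s) → NoConsecutiveRepeat s
    to []          _           = tt
    to (a ∷ [])    _           = tt
    to (a ∷ b ∷ s) (fa≢fb , h) = fa≢fb ∘ cong f , to (b ∷ s) h
    from : ∀ s → NoConsecutiveRepeat s → NoConsecutiveRepeat (map f s)
    from []          _         = tt
    from (a ∷ [])    _         = tt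
    from (a ∷ b ∷ s) (a≢b , h) = a≢b ∘ f-inj , from (b ∷ s) h

  NoConsecutiveRepeat-≡map : ∀ {B : Set} {f : A → B} → Injective _≡_ _≡_ f → ∀ {t s} →
    t ≡ map f s → NoConsecutiveRepeat t ⇔ NoConsecutiveRepeat s
  NoConsecutiveRepeat-≡map f-inj {s = s} refl = NoConsecutiveRepeat-map f-inj s

  module _ {P : Pred A 0ℓ} (P? : Decidable P) where

    filter-map : ∀ {B : Set} (f : B → A) xs → filter P? (map f xs) ≡ map f (filter (P? ∘ f) xs)
    filter-map f []       = refl
    filter-map f (x ∷ xs) with P? (f x)
    ... | yes _ = cong (f x ∷_) (filter-map f xs)
    ... | no  _ = filter-map f xs

    filter-reverse : ∀ xs → filter P? (reverse xs) ≡ reverse (filter P? xs)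
    filter-reverse []       = refl
    filter-reverse (x ∷ xs) = begin
      filter P? (reverse (x ∷ xs))              ≡⟨ cong (filter P?) (unfold-reverse x xs) ⟩
      filter P? (reverse xs ++ [ x ])           ≡⟨ filter-++ P? (reverse xs) [ x ] ⟩
      filter P? (reverse xs) ++ filter P? [ x ] ≡⟨ cong (_++ filter P? [ x ]) (filter-reverse xs) ⟩
      reverse (filter P? xs) ++ filter P? [ x ] ≡⟨ snoc ⟩
      reverse (filter P? (x ∷ xs))              ∎
      where
      open ≡-Reasoning
      snoc : reverse (filter P? xs) ++ filter P? [ x ] ≡ reverse (filter P? (x ∷ xs))
      snoc with P? x
      ... | yes _ = sym (unfold-reverse x (filter P? xs))
      ... | no  _ = ++-identityʳ (reverse (filter P? xs))

    filter-concatMap : ∀ {B : Set} (g : B → List A) xs →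
      filter P? (concatMap g xs) ≡ concatMap (filter P? ∘ g) xs
    filter-concatMap g []       = refl
    filter-concatMap g (x ∷ xs) =
      trans (filter-++ P? (g x) (concatMap g xs)) (cong (filter P? (g x) ++_) (filter-concatMap g xs))

    filter-filter : ∀ {Q : Pred A 0ℓ} (Q? : Decidable Q) xs →
      filter P? (filter Q? xs) ≡ filter (P? ∩? Q?) xs
    filter-filter Q? []       = refl
    filter-filter Q? (x ∷ xs) with Q? x
    ... | yes _ with P? x
    ...   | yes _ = cong (x ∷_) (filter-filter Q? xs)
    ...   | no  _ = filter-filter Q? xs
    filter-filter Q? (x ∷ xs) | no _ with P? x
    ...   | yes _ = filter-filter Q? xs
    ...   | no  _ = filter-filter Q? xs

module _ {A : Set} (_≟_ : DecidableEquality A) where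

  -- Alternate _≟_ x y w unfolds to NoConsecutiveRepeat (filter (either? x y) w).
  either? : (x y : A) → Decidable (λ z → z ≡ x ⊎ z ≡ y)
  either? x y z = (z ≟ x) ⊎-dec (z ≟ y)

  filter-≟-unique : ∀ {a xs} → Unique xs → a ∈ xs → filter (_≟ a) xs ≡ [ a ]
  filter-≟-unique {a} (a∉xs ∷ _) (here refl) =
    trans (filter-accept (_≟ a) refl)
          (cong (a ∷_) (filter-none (_≟ a) (All.map (λ a≢z → a≢z ∘ sym) a∉xs)))
  filter-≟-unique {a} {x ∷ _} (x∉xs ∷ xs-unique) (there a∈xs) with x ≟ a
  ... | yes refl = ⊥-elim (All.lookup x∉xs a∈xs refl)
  ... | no  _    = filter-≟-unique xs-unique a∈xs

  dedup : List A → List A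
  dedup = deduplicate _≟_

  filter-dedup : ∀ {P : Pred A 0ℓ} (P? : Decidable P) xs → filter P? (dedup xs) ≡ dedup (filter P? xs)
  filter-dedup P? []       = refl
  filter-dedup {P} P? (x ∷ xs) with P? x
  ... | yes _  = cong (x ∷_) (begin
    filter P? (filter x≢? (dedup xs))  ≡⟨ filter-filter P? x≢? (dedup xs) ⟩
    filter (P? ∩? x≢?) (dedup xs)      ≡⟨ filter-≐ _ (x≢? ∩? P?) (swap , swap) (dedup xs) ⟩
    filter (x≢? ∩? P?) (dedup xs)      ≡⟨ filter-filter x≢? P? (dedup xs) ⟨
    filter x≢? (filter P? (dedup xs))  ≡⟨ cong (filter x≢?) (filter-dedup P? xs) ⟩
    filter x≢? (dedup (filter P? xs))  ∎)
    where
    open ≡-Reasoning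
    x≢? = ¬? ∘ (x ≟_)
  ... | no ¬Px = begin
    filter P? (filter x≢? (dedup xs))  ≡⟨ filter-filter P? x≢? (dedup xs) ⟩
    filter (P? ∩? x≢?) (dedup xs)      ≡⟨ filter-≐ _ P? (proj₁ , λ Pz → Pz , x≢ Pz) (dedup xs) ⟩
    filter P? (dedup xs)               ≡⟨ filter-dedup P? xs ⟩
    dedup (filter P? xs)               ∎
    where
    open ≡-Reasoning
    x≢? = ¬? ∘ (x ≟_)
    x≢ : ∀ {z} → P z → x ≢ z
    x≢ Pz refl = ¬Px Pz

  dedup-pair : ∀ {c₁ c₂ r} → c₁ ≢ c₂ → All (λ z → z ≡ c₁ ⊎ z ≡ c₂) r →
    dedup (c₁ ∷ c₂ ∷ r) ≡ c₁ ∷ c₂ ∷ []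
  dedup-pair {c₁} {c₂} {r} c₁≢c₂ r⊆c₁c₂ = cong (c₁ ∷_) (begin
    filter (≢? c₁) (c₂ ∷ filter (≢? c₂) (dedup r)) ≡⟨ filter-accept (≢? c₁) c₁≢c₂ ⟩
    c₂ ∷ filter (≢? c₁) (filter (≢? c₂) (dedup r)) ≡⟨ cong (c₂ ∷_) (filter-filter _ (≢? c₂) (dedup r)) ⟩
    c₂ ∷ filter (≢? c₁ ∩? ≢? c₂) (dedup r)         ≡⟨ cong (c₂ ∷_) (filter-none _ dedup-r⊆c₁c₂) ⟩
    c₂ ∷ []                                          ∎)
    where
    open ≡-Reasoning
    ≢? : (c : A) → Decidable (c ≢_)
    ≢? c = ¬? ∘ (c ≟_)
    excluded : ∀ {z} → z ≡ c₁ ⊎ z ≡ c₂ → ¬ (c₁ ≢ z × c₂ ≢ z)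
    excluded (inj₁ refl) (c₁≢z , _) = c₁≢z refl
    excluded (inj₂ refl) (_ , c₂≢z) = c₂≢z refl
    dedup-r⊆c₁c₂ : All (λ z → ¬ (c₁ ≢ z × c₂ ≢ z)) (dedup r)
    dedup-r⊆c₁c₂ = All.map excluded (All.deduplicate⁺ _≟_ r⊆c₁c₂)

  either-relabel : ∀ {x y c₁ c₂ z : A} → c₁ ≢ c₂ →
    c₁ ≡ x ⊎ c₁ ≡ y → c₂ ≡ x ⊎ c₂ ≡ y → z ≡ x ⊎ z ≡ y → z ≡ c₁ ⊎ z ≡ c₂
  either-relabel _     (inj₁ refl) (inj₂ refl) = id
  either-relabel _     (inj₂ refl) (inj₁ refl) = Sum.swap
  either-relabel c₁≢c₂ (inj₁ refl) (inj₁ refl) = ⊥-elim (c₁≢c₂ refl)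
  either-relabel c₁≢c₂ (inj₂ refl) (inj₂ refl) = ⊥-elim (c₁≢c₂ refl)

  NoConsecutiveRepeat-dedup-++ : ∀ {x y} → x ≢ y → ∀ s → All (λ z → z ≡ x ⊎ z ≡ y) s →
    x ∈ s → y ∈ s → NoConsecutiveRepeat s → NoConsecutiveRepeat (dedup s ++ s)
  NoConsecutiveRepeat-dedup-++ x≢y (c ∷ []) _ (here refl) (here refl) _ = ⊥-elim (x≢y refl)
  NoConsecutiveRepeat-dedup-++ x≢y (c₁ ∷ c₂ ∷ r) (e₁ ∷ e₂ ∷ r⊆xy) _ _ (c₁≢c₂ , h) =
    subst (λ t → NoConsecutiveRepeat (t ++ c₁ ∷ c₂ ∷ r))
          (sym (dedup-pair c₁≢c₂ (All.map (either-relabel c₁≢c₂ e₁ e₂) r⊆xy)))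
          (c₁≢c₂ , c₁≢c₂ ∘ sym , c₁≢c₂ , h)

  alternate-dedup-++ : ∀ {x y} → x ≢ y → ∀ v → x ∈ v → y ∈ v →
    Alternate _≟_ x y (dedup v ++ v) ⇔ Alternate _≟_ x y v
  alternate-dedup-++ {x} {y} x≢y v x∈v y∈v = mk⇔
    (λ h → NoConsecutiveRepeat-++⁻ʳ (filter xy? (dedup v)) (subst NoConsecutiveRepeat split h))
    (λ h → subst NoConsecutiveRepeat (sym split)
      (subst (λ t → NoConsecutiveRepeat (t ++ filter xy? v)) (sym (filter-dedup xy? v))
        (NoConsecutiveRepeat-dedup-++ x≢y (filter xy? v) (All.all-filter xy? v)
          (∈-filter⁺ xy? x∈v (inj₁ refl)) (∈-filter⁺ xy? y∈v (inj₂ refl)) h)))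
    where
    xy? = either? x y
    split : filter xy? (dedup v ++ v) ≡ filter xy? (dedup v) ++ filter xy? v
    split = filter-++ xy? (dedup v) v

Represents : {V : Set} → DecidableEquality V → (V → V → Set) → List V → Set
Represents _≟_ E w = (∀ x → x ∈ w) × (∀ x y → x ≢ y → (E x y ⇔ Alternate _≟_ x y w))

ImageRel : {A B : Set} → (A → B) → (A → A → Set) → B → B → Set
ImageRel f E u x = ∃[ p ] ∃[ q ] (E p q × f p ≡ u × f q ≡ x)

module _ {A B : Set} {f : A → B} (f-inj : Injective _≡_ _≡_ f) {E : A → A → Set} where

  imageRel-injective : ∀ {p q} → ImageRel f E (f p) (f q) ⇔ E p q
  imageRel-injective = mk⇔
    (λ { (_ , _ , e , fp′≡fp , fq′≡fq) → subst₂ E (f-inj fp′≡fp) (f-inj fq′≡fq) e })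
    (λ e → _ , _ , e , refl , refl)

  imageRel-irreflexive : (∀ p → ¬ E p p) → ∀ u → ¬ ImageRel f E u u
  imageRel-irreflexive E-irrefl _ (p , q , e , refl , fq≡fp) with refl ← f-inj fq≡fp = E-irrefl p e

twice : {A : Set} → A → List A
twice u = u ∷ u ∷ []

¬NoConsecutiveRepeat-filter-twice : ∀ {A : Set} {R : Pred A 0ℓ} (R? : Decidable R) {u} → R u →
  ∀ {l} → u ∈ l → ∀ ys → ¬ NoConsecutiveRepeat (filter R? (concatMap twice l) ++ ys)
¬NoConsecutiveRepeat-filter-twice {R = R} R? {u} Ru {z ∷ l} u∈zl ys = case (R? z)
  where
  case : Dec (R z) → ¬ NoConsecutiveRepeat (filter R? (concatMap twice (z ∷ l)) ++ ys)
  case (yes Rz) h = proj₁ (subst NoConsecutiveRepeat (cong (_++ ys) kept) h) refl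
    where
    kept : filter R? (z ∷ z ∷ concatMap twice l) ≡ z ∷ z ∷ filter R? (concatMap twice l)
    kept = trans (filter-accept R? Rz) (cong (z ∷_) (filter-accept R? Rz))
  case (no ¬Rz) h = ¬NoConsecutiveRepeat-filter-twice R? Ru (Any.tail (λ { refl → ¬Rz Ru }) u∈zl) ys
    (subst NoConsecutiveRepeat (cong (_++ ys) dropped) h)
    where
    dropped : filter R? (z ∷ z ∷ concatMap twice l) ≡ filter R? (concatMap twice l)
    dropped = trans (filter-reject R? ¬Rz) (filter-reject R? ¬Rz)

module Extension {m n : ℕ} (f : Fin m → Fin n) (f-inj : Injective _≡_ _≡_ f) where

  Image : Pred (Fin n) 0ℓ
  Image u = ∃[ p ] f p ≡ u

  Image? : Decidable Image
  Image? u = Finₚ.any? (λ p → f p Fin.≟ u)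

  isolated : List (Fin n)
  isolated = filter (¬? ∘ Image?) (allFin n)

  extend : List (Fin m) → List (Fin n)
  extend w = concatMap twice isolated ++ map f w

  ¬alternate-extend : ∀ {u} → ¬ Image u → ∀ {R : Pred (Fin n) 0ℓ} (R? : Decidable R) → R u →
    ∀ w → ¬ NoConsecutiveRepeat (filter R? (extend w))
  ¬alternate-extend {u} ¬Iu R? Ru w h =
    ¬NoConsecutiveRepeat-filter-twice R? Ru (∈-filter⁺ (¬? ∘ Image?) (∈-allFin u) ¬Iu)
      (filter R? (map f w))
      (subst NoConsecutiveRepeat (filter-++ R? (concatMap twice isolated) (map f w)) h)

  alternate-extend : ∀ {p q} w → Alternate Fin._≟_ (f p) (f q) (extend w) ⇔ Alternate Fin._≟_ p q w
  alternate-extend {p} {q} w = NoConsecutiveRepeat-≡map f-inj (begin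
    filter P? (concatMap twice isolated ++ map f w)
      ≡⟨ filter-++ P? (concatMap twice isolated) (map f w) ⟩
    filter P? (concatMap twice isolated) ++ filter P? (map f w)
      ≡⟨ cong (_++ filter P? (map f w)) isolated-invisible ⟩
    filter P? (map f w)
      ≡⟨ filter-map P? f w ⟩
    map f (filter (P? ∘ f) w)
      ≡⟨ cong (map f) (filter-≐ (P? ∘ f) pq? P∘f≐pq w) ⟩
    map f (filter pq? w)
      ∎)
    where
    open ≡-Reasoning
    P? = either? Fin._≟_ (f p) (f q)
    pq? = either? Fin._≟_ p q
    P∘f≐pq = (λ {_} → Sum.map f-inj f-inj) , (λ {_} → Sum.map (cong f) (cong f))
    isolated-invisible : filter P? (concatMap twice isolated) ≡ []
    isolated-invisible =
      filter-none P? (All.concat⁺ (All.map⁺ (All.map invisible (All.all-filter (¬? ∘ Image?) (allFin n)))))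
      where
      invisible : ∀ {z} → ¬ Image z → All (λ c → ¬ (c ≡ f p ⊎ c ≡ f q)) (twice z)
      invisible ¬Iz = ¬Pz ∷ ¬Pz ∷ []
        where ¬Pz = [ (λ z≡fp → ¬Iz (p , sym z≡fp)) , (λ z≡fq → ¬Iz (q , sym z≡fq)) ]′

  extend-represents : ∀ {E w} → Represents Fin._≟_ E w → Represents Fin._≟_ (ImageRel f E) (extend w)
  extend-represents {E} {w} (∈-w , represents) = ∈-extend , represents′
    where
    ∈-extend : ∀ u → u ∈ extend w
    ∈-extend u with Image? u
    ... | yes (p , refl) = ∈-++⁺ʳ (concatMap twice isolated) (∈-map⁺ f (∈-w p))
    ... | no  ¬Iu        = ∈-++⁺ˡ (∈-concatMap⁺ twice (Any.map (λ { refl → here refl })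
                                     (∈-filter⁺ (¬? ∘ Image?) (∈-allFin u) ¬Iu)))
    represents′ : ∀ u x → u ≢ x → ImageRel f E u x ⇔ Alternate Fin._≟_ u x (extend w)
    represents′ u x u≢x with Image? u | Image? x
    ... | yes (p , refl) | yes (q , refl) =
      ⇔.trans (imageRel-injective f-inj)
              (⇔.trans (represents p q (u≢x ∘ cong f)) (⇔.sym (alternate-extend w)))
    ... | no ¬Iu | _ = mk⇔ (λ (p , _ , _ , fp≡u , _) → ⊥-elim (¬Iu (p , fp≡u)))
                           (⊥-elim ∘ ¬alternate-extend ¬Iu (either? Fin._≟_ u x) (inj₁ refl) w)
    ... | _ | no ¬Ix = mk⇔ (λ (_ , q , _ , _ , fq≡x) → ⊥-elim (¬Ix (q , fq≡x)))
                           (⊥-elim ∘ ¬alternate-extend ¬Ix (either? Fin._≟_ u x) (inj₂ refl) w)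

module Inflation {A B : Set} (_≟A_ : DecidableEquality A) (_≟B_ : DecidableEquality B)
                 (bs : List B) (bs-unique : Unique bs) (∈-bs : ∀ b → b ∈ bs) where

  _≟_ : DecidableEquality (A × B)
  _≟_ = ≡-dec _≟A_ _≟B_

  supervertex : A → List (A × B)
  supervertex u = map (u ,_) bs

  inflate : List A → List (A × B)
  inflate v = reverse (concatMap supervertex (reverse (dedup _≟A_ v))) ++ concatMap supervertex v

  filter-supervertex-single : ∀ {P : Pred (A × B) 0ℓ} (P? : Decidable P) {z c} →
    (∀ {d} → P (z , d) → d ≡ c) → P (z , c) → filter P? (supervertex z) ≡ [ z , c ]
  filter-supervertex-single P? {z} {c} unique Pzc = begin
    filter P? (map (z ,_) bs)            ≡⟨ filter-map P? (z ,_) bs ⟩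
    map (z ,_) (filter (P? ∘ (z ,_)) bs) ≡⟨ cong (map (z ,_)) (filter-≐ _ (_≟B c) P≐≡c bs) ⟩
    map (z ,_) (filter (_≟B c) bs)       ≡⟨ cong (map (z ,_)) (filter-≟-unique _≟B_ bs-unique (∈-bs c)) ⟩
    [ z , c ]                            ∎
    where
    open ≡-Reasoning
    P≐≡c = (λ {_} → unique) , λ { refl → Pzc }

  filter-supervertex-empty : ∀ {P : Pred (A × B) 0ℓ} (P? : Decidable P) {z} →
    (∀ {d} → ¬ P (z , d)) → filter P? (supervertex z) ≡ []
  filter-supervertex-empty P? {z} ¬P = filter-none P? (All.map⁺ (All.universal (λ _ → ¬P) bs))

  module DistinctSupervertices {u u′ : A} (u≢u′ : u ≢ u′) (a b : B) where

    pick : A → B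
    pick z with z ≟A u
    ... | yes _ = a
    ... | no  _ = b

    pick-u : pick u ≡ a
    pick-u with u ≟A u
    ... | yes _   = refl
    ... | no  u≢u = ⊥-elim (u≢u refl)

    pick-u′ : pick u′ ≡ b
    pick-u′ with u′ ≟A u
    ... | yes u′≡u = ⊥-elim (u≢u′ (sym u′≡u))
    ... | no  _    = refl

    tag : A → A × B
    tag z = z , pick z

    tag-injective : Injective _≡_ _≡_ tag
    tag-injective = cong proj₁

    P? = either? _≟_ (u , a) (u′ , b)
    Q? = either? _≟A_ u u′

    filter-supervertex : ∀ z → filter P? (supervertex z) ≡ map tag (filter Q? [ z ])
    filter-supervertex z with z ≟A u | z ≟A u′
    ... | yes refl | _        =
      trans (filter-supervertex-single P? onlyA (inj₁ refl)) (cong (λ c → [ u , c ]) (sym pick-u))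
      where
      onlyA : ∀ {d} → (u , d) ≡ (u , a) ⊎ (u , d) ≡ (u′ , b) → d ≡ a
      onlyA (inj₁ refl) = refl
      onlyA (inj₂ e)    = ⊥-elim (u≢u′ (cong proj₁ e))
    ... | no  _    | yes refl =
      trans (filter-supervertex-single P? onlyB (inj₂ refl)) (cong (λ c → [ u′ , c ]) (sym pick-u′))
      where
      onlyB : ∀ {d} → (u′ , d) ≡ (u , a) ⊎ (u′ , d) ≡ (u′ , b) → d ≡ b
      onlyB (inj₁ e)    = ⊥-elim (u≢u′ (sym (cong proj₁ e)))
      onlyB (inj₂ refl) = refl
    ... | no z≢u   | no z≢u′  = filter-supervertex-empty P? [ z≢u ∘ cong proj₁ , z≢u′ ∘ cong proj₁ ]′

    filter-concatMap-supervertex : ∀ l → filter P? (concatMap supervertex l) ≡ map tag (filter Q? l)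
    filter-concatMap-supervertex l = begin
      filter P? (concatMap supervertex l)          ≡⟨ filter-concatMap P? supervertex l ⟩
      concatMap (filter P? ∘ supervertex) l        ≡⟨ concatMap-cong filter-supervertex l ⟩
      concatMap (map tag ∘ filter Q? ∘ [_]) l      ≡⟨ map-concatMap tag (filter Q? ∘ [_]) l ⟨
      map tag (concatMap (filter Q? ∘ [_]) l)      ≡⟨ cong (map tag) (filter-concatMap Q? [_] l) ⟨
      map tag (filter Q? (concatMap [_] l))        ≡⟨ cong (map tag ∘ filter Q?) (concatMap-pure l) ⟩
      map tag (filter Q? l)                        ∎
      where open ≡-Reasoning

    filter-inflate : ∀ v → filter P? (inflate v) ≡ map tag (filter Q? (dedup _≟A_ v ++ v))
    filter-inflate v = begin
      filter P? (reverse X ++ concatMap supervertex v)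
        ≡⟨ filter-++ P? (reverse X) (concatMap supervertex v) ⟩
      filter P? (reverse X) ++ filter P? (concatMap supervertex v)
        ≡⟨ cong₂ _++_ prefix (filter-concatMap-supervertex v) ⟩
      map tag (filter Q? π) ++ map tag (filter Q? v)
        ≡⟨ map-++ tag (filter Q? π) (filter Q? v) ⟨
      map tag (filter Q? π ++ filter Q? v)
        ≡⟨ cong (map tag) (filter-++ Q? π v) ⟨
      map tag (filter Q? (π ++ v))
        ∎
      where
      open ≡-Reasoning
      π = dedup _≟A_ v
      X = concatMap supervertex (reverse π)
      prefix : filter P? (reverse X) ≡ map tag (filter Q? π)
      prefix = begin
        filter P? (reverse X)                      ≡⟨ filter-reverse P? X ⟩
        reverse (filter P? X)                      ≡⟨ cong reverse (filter-concatMap-supervertex (reverse π)) ⟩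
        reverse (map tag (filter Q? (reverse π)))  ≡⟨ cong (reverse ∘ map tag) (filter-reverse Q? π) ⟩
        reverse (map tag (reverse (filter Q? π)))  ≡⟨ cong reverse (reverse-map tag (filter Q? π)) ⟩
        reverse (reverse (map tag (filter Q? π)))  ≡⟨ reverse-involutive (map tag (filter Q? π)) ⟩
        map tag (filter Q? π)                      ∎

    alternate-inflate : ∀ v → u ∈ v → u′ ∈ v →
      Alternate _≟_ (u , a) (u′ , b) (inflate v) ⇔ Alternate _≟A_ u u′ v
    alternate-inflate v u∈v u′∈v = ⇔.trans
      (NoConsecutiveRepeat-≡map tag-injective (filter-inflate v))
      (alternate-dedup-++ _≟A_ u≢u′ v u∈v u′∈v)

  module SameSupervertex (u : A) (a b : B) where

    P? = either? _≟_ (u , a) (u , b)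

    block : List (A × B)
    block = filter P? (supervertex u)

    filter-concatMap-supervertex-prefix : ∀ {l} → u ∈ l →
      ∃[ r ] filter P? (concatMap supervertex l) ≡ block ++ r
    filter-concatMap-supervertex-prefix {z ∷ l} u∈zl with z ≟A u
    ... | yes refl = _ , filter-++ P? (supervertex z) (concatMap supervertex l)
    ... | no  z≢u  with r , eq ← filter-concatMap-supervertex-prefix (Any.tail (z≢u ∘ sym) u∈zl) =
      r , trans (filter-++ P? (supervertex z) (concatMap supervertex l))
                (trans (cong (_++ _) invisible) eq)
      where
      invisible : filter P? (supervertex z) ≡ []
      invisible = filter-supervertex-empty P? (z≢u ∘ [ cong proj₁ , cong proj₁ ]′)

    ¬alternate-inflate : ∀ v → u ∈ v → ¬ Alternate _≟_ (u , a) (u , b) (inflate v)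
    ¬alternate-inflate v u∈v h
      with r₁ , eq₁ ← filter-concatMap-supervertex-prefix (Anyₚ.reverse⁺ (∈-deduplicate⁺ _≟A_ u∈v))
         | r₂ , eq₂ ← filter-concatMap-supervertex-prefix u∈v =
      ¬NoConsecutiveRepeat-mirror block ua∈block r₁ r₂ (subst NoConsecutiveRepeat split h)
      where
      ua∈block : (u , a) ∈ block
      ua∈block = ∈-filter⁺ P? (∈-map⁺ (u ,_) (∈-bs a)) (inj₁ refl)
      X = concatMap supervertex (reverse (dedup _≟A_ v))
      Y = concatMap supervertex v
      split : filter P? (inflate v) ≡ reverse (block ++ r₁) ++ block ++ r₂
      split = begin
        filter P? (reverse X ++ Y)            ≡⟨ filter-++ P? (reverse X) Y ⟩
        filter P? (reverse X) ++ filter P? Y  ≡⟨ cong (_++ filter P? Y) (filter-reverse P? X) ⟩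
        reverse (filter P? X) ++ filter P? Y  ≡⟨ cong₂ (λ s t → reverse s ++ t) eq₁ eq₂ ⟩
        reverse (block ++ r₁) ++ block ++ r₂  ∎
        where open ≡-Reasoning

  inflate-represents : ∀ {E : A → A → Set} → (∀ u → ¬ E u u) → ∀ {v} → Represents _≟A_ E v →
    Represents _≟_ (λ p q → E (proj₁ p) (proj₁ q)) (inflate v)
  inflate-represents {E} E-irrefl {v} (∈-v , represents) = ∈-inflate , represents′
    where
    ∈-inflate : ∀ p → p ∈ inflate v
    ∈-inflate (u , c) =
      ∈-++⁺ʳ _ (∈-concatMap⁺ supervertex (Any.map (λ { refl → ∈-map⁺ (u ,_) (∈-bs c) }) (∈-v u)))
    represents′ : ∀ p q → p ≢ q → E (proj₁ p) (proj₁ q) ⇔ Alternate _≟_ p q (inflate v)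
    represents′ (u , a) (u′ , b) _ with u ≟A u′
    ... | yes refl = mk⇔ (⊥-elim ∘ E-irrefl u) (⊥-elim ∘ SameSupervertex.¬alternate-inflate u a b v (∈-v u))
    ... | no  u≢u′ = ⇔.trans (represents u u′ u≢u′)
                             (⇔.sym (DistinctSupervertices.alternate-inflate u≢u′ a b v (∈-v u) (∈-v u′)))

adj-irreflexive : ∀ {n} (G : Graph n) u → adj G u u ≢ true
adj-irreflexive G u adj≡true with () ← trans (sym (irrefl G u)) adj≡true

theorem4 : {n₁ n₂ m : ℕ} (G₁ : Graph n₁) (G₂ : Graph n₂)
           (G₁' : Graph m) (f : Fin m → Fin n₁) →
           IsSubgraphVia G₁' G₁ f →
           WordRepGraph G₁' →
           WordRepresentable (Fin n₁ × Fin n₂) _≟ₚ_ (LexMapAdj {m} {n₁} {n₂} G₁' f)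
theorem4 {n₂ = n₂} G₁ G₂ G₁' f (f-inj , _) (w , represents-G₁') =
  inflate (extend w) ,
  inflate-represents (imageRel-irreflexive f-inj (adj-irreflexive G₁')) (extend-represents represents-G₁')
  where
  open Extension f f-inj
  open Inflation Fin._≟_ Fin._≟_ (allFin n₂) (allFin⁺ n₂) ∈-allFin
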